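{- Let $\mathcal O\subseteq\mathbb C$ be a subring containing $1$ and $P\in\mathrm{PCF}(\mathcal O)$. Let $\mathsf{SF}(P)_{\mathrm{red}}$ be the unique reduced finite sequence equivalent to $\mathsf{SF}(P)$. Then $P_{\mathrm{red}}=\mathsf{SR}(\mathsf{SF}(P)_{\mathrm{red}})$ is the unique reduced element of $\mathrm{RCF}(\mathcal O)$ such that $P_{\mathrm{red}}\sim P$.
   Context: A PCF over $\mathcal O$ of type $(N,k)$ ($N\ge0,k\ge1$), $P=[b_1,\dots,b_N,\overline{a_1,\dots,a_k}]$, $b_i,a_i\in\mathcal O$, is the infinite sequence $b_1,\dots,b_N,a_1,\dots,a_k,a_1,\dots$ together with its type; $\mathrm{PCF}(\mathcal O)$ is the set of these and $\mathrm{RCF}(\mathcal O)$ the subset of those of type $(0,k)$ (purely periodic). A finite sequence $[c_1,\dots,c_n]$ is reduced if $c_i\ne0$ for $2\le i\le n-1$; an RCF $[\overline{a_1,\dots,a_k}]$ is reduced if $a_i\ne0$ for $2\le i\le k-1$. On finite sequences, $\sim$ is generated by $u[x,0,y]v\sim u[x+y]v$ ($u,v$ sequences, $x,y\in\mathcal O$); every finite sequence is equivalent to a unique reduced one. $\mathsf{SF}(P)=[b_1,\dots,b_N,a_1,\dots,a_k,0,-b_N,\dots,-b_1,0]$ if $N>0$, $[a_1,\dots,a_k]$ if $N=0$; $\mathsf{SR}([c_1,\dots,c_n])=[\overline{c_1,\dots,c_n}]$ of type $(0,n)$. For PCFs, $P\sim P'$ means $\mathsf{SF}(P)\sim\mathsf{SF}(P')$.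 -}

module Defs where

open import Level using (Level; _⊔_)
open import Algebra.Bundles using (CommutativeRing)
open import Data.List using (List; []; _∷_; _++_; map; reverse)
open import Data.List.NonEmpty using (List⁺; toList)
open import Data.Product using (_×_)
open import Data.Unit.Polymorphic using (⊤)
open import Relation.Binary.PropositionalEquality using (_≡_; _≢_)
open import Relation.Binary.Construct.Closure.Equivalence using (EqClosure)

-- All notions are defined relative to a commutative ring O (with 1).
-- Equality of ring elements / sequences is propositional equality _≡_ .
module PCFDefs {c ℓ : Level} (R : CommutativeRing c ℓ) where
  open CommutativeRing R renaming (Carrier to O)

  Interior : List O → Set c
  Interior []           = ⊤
  Interior (_ ∷ [])     = ⊤
  Interior (y ∷ z ∷ zs) = (y ≢ 0#) × Interior (z ∷ zs)

  Reduced : List O → Set c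
  Reduced []       = ⊤
  Reduced (_ ∷ xs) = Interior xs

  data Step : List O → List O → Set c where
    step : (u : List O) (x y : O) (v : List O) →
           Step (u ++ x ∷ 0# ∷ y ∷ v) (u ++ (x + y) ∷ v)

  _∼ₛ_ : List O → List O → Set c
  _∼ₛ_ = EqClosure Step

  -- A PCF [b₁,…,b_N, overline{a₁,…,a_k}] of type (N,k), k ≥ 1:
  -- pre = [b₁,…,b_N] (N = its length), per = [a₁,…,a_k] nonempty (k = its length).
  record PCF : Set c where
    constructor pcf
    field
      pre : List O
      per : List⁺ O
  open PCF public

  -- RCF(O): the purely periodic ones (type (0,k)).
  IsRCF : PCF → Set c
  IsRCF P = pre P ≡ []

  ReducedRCF : PCF → Set c
  ReducedRCF P = IsRCF P × Reduced (toList (per P))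

  SF : PCF → List O
  SF (pcf [] a)         = toList a
  SF (pcf (b ∷ bs) a)   =
    (b ∷ bs) ++ toList a ++ 0# ∷ map -_ (reverse (b ∷ bs)) ++ 0# ∷ []

  SR : List⁺ O → PCF
  SR s = pcf [] s

  _∼_ : PCF → PCF → Set c
  P ∼ P' = SF P ∼ₛ SF P'

{-# OPTIONS --safe #-}
module Submission where

-- Orient the generating relation as the contraction x ∷ 0 ∷ y ∷ v ↝ (x + y) ∷ v.
-- Any two contractions of the same sequence can be joined in at most one step
-- each (overlapping redexes x,0,y,0,z resolve by associativity of +), so the
-- rewriting system is confluent.  Reduced sequences are exactly those with no
-- redex, hence two equivalent reduced sequences coincide.  Contractions never
-- produce the empty sequence, so the reduced form of the nonempty SF(P) is a
-- nonempty period, i.e. a reduced RCF; any reduced RCF Q ∼ P has SF(Q) its own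
-- period, which must then equal that reduced form.

open import Defs
open import Level using (Level)
open import Algebra.Bundles using (CommutativeRing)
open import Data.Bool using (false)
open import Data.Empty using (⊥; ⊥-elim)
open import Data.List using (List; []; _∷_; _++_; null)
open import Data.List.NonEmpty using (List⁺; toList) renaming (_∷_ to _∷⁺_)
open import Data.Product using (Σ-syntax; ∃-syntax; _×_; _,_)
open import Relation.Binary.Core using (Rel; _⇒_)
open import Relation.Binary.PropositionalEquality
  using (_≡_; refl; sym; trans; cong₂; isEquivalence)
open import Relation.Binary.Construct.Closure.Reflexive using (ReflClosure; [_]; reflexive)
  renaming (refl to stay)
open import Relation.Binary.Construct.Closure.ReflexiveTransitive
  using (Star; ε; _◅_; _◅◅_)
import Relation.Binary.Construct.Closure.Equivalence as EqClosure
open import Relation.Binary.Rewriting using (Confluent; IsNormalForm; conf⇒unf)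

module _ {a ℓ} {A : Set a} (_⟶_ : Rel A ℓ) where

  Subcommutative : Set _
  Subcommutative = ∀ {x y z} → x ⟶ y → x ⟶ z →
    ∃[ w ] (ReflClosure _⟶_ y w × ReflClosure _⟶_ z w)

module _ {a ℓ} {A : Set a} {_⟶_ : Rel A ℓ} where

  private
    _⟶⁼_ = ReflClosure _⟶_
    _—↠_ = Star _⟶_

  ⟶⁼⇒—↠ : _⟶⁼_ ⇒ _—↠_
  ⟶⁼⇒—↠ stay  = ε
  ⟶⁼⇒—↠ [ r ] = r ◅ ε

  strip : Subcommutative _⟶_ → ∀ {x y z} → x ⟶ y → x —↠ z →
          ∃[ w ] (y —↠ w × z ⟶⁼ w)
  strip sc {y = y} r ε = y , ε , [ r ]
  strip sc r (r′ ◅ rs) with sc r r′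
  ... | w , y⟶⁼w , stay      = _ , ⟶⁼⇒—↠ y⟶⁼w ◅◅ rs , stay
  ... | w , y⟶⁼w , [ z′⟶w ] with strip sc z′⟶w rs
  ...   | v , w—↠v , z⟶⁼v    = v , ⟶⁼⇒—↠ y⟶⁼w ◅◅ w—↠v , z⟶⁼v

  subcommutative⇒confluent : Subcommutative _⟶_ → Confluent _⟶_
  subcommutative⇒confluent sc {C = z} ε x—↠z = z , x—↠z , ε
  subcommutative⇒confluent sc (r ◅ rs) x—↠z with strip sc r x—↠z
  ... | w , y′—↠w , z⟶⁼w with subcommutative⇒confluent sc rs y′—↠w
  ...   | v , y—↠v , w—↠v = v , y—↠v , ⟶⁼⇒—↠ z⟶⁼w ◅◅ w—↠v

module Contraction {c ℓ : Level} (R : CommutativeRing c ℓ)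
  (≈⇒≡ : ∀ {x y} → CommutativeRing._≈_ R x y → x ≡ y) where

  open CommutativeRing R using (0#; _+_; +-identityˡ; +-identityʳ; +-assoc)
    renaming (Carrier to O)
  open PCFDefs R

  infix 4 _↝_

  data _↝_ : List O → List O → Set c where
    here  : ∀ x y v → x ∷ 0# ∷ y ∷ v ↝ (x + y) ∷ v
    there : ∀ z {u v} → u ↝ v → z ∷ u ↝ z ∷ v

  Step⇒↝ : Step ⇒ _↝_
  Step⇒↝ (step u x y v) = inContext u
    where
    inContext : ∀ u → u ++ x ∷ 0# ∷ y ∷ v ↝ u ++ (x + y) ∷ v
    inContext []      = here x y v
    inContext (z ∷ u) = there z (inContext u)

  infix 4 _↝⁼_
  private
    _↝⁼_ = ReflClosure _↝_

  there⁼ : ∀ z {u v} → u ↝⁼ v → z ∷ u ↝⁼ z ∷ v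
  there⁼ z stay  = stay
  there⁼ z [ r ] = [ there z r ]

  here-there-join : ∀ x y v {w} → 0# ∷ y ∷ v ↝ w →
                    ∃[ t ] ((x + y) ∷ v ↝⁼ t × x ∷ w ↝⁼ t)
  here-there-join x y v (here _ y′ v′) = _ , stay , reflexive x∷0+y′≡x+0∷y′
    where
    x∷0+y′≡x+0∷y′ : x ∷ (0# + y′) ∷ v′ ≡ (x + 0#) ∷ y′ ∷ v′
    x∷0+y′≡x+0∷y′ = cong₂ (λ s t → s ∷ t ∷ v′)
                          (sym (≈⇒≡ (+-identityʳ x))) (≈⇒≡ (+-identityˡ y′))
  here-there-join x y v (there _ (here _ z v′)) =
    _ , [ here (x + y) z v′ ] , [ here′ ]
    where
    here′ : x ∷ 0# ∷ (y + z) ∷ v′ ↝ ((x + y) + z) ∷ v′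
    here′ rewrite ≈⇒≡ (+-assoc x y z) = here x (y + z) v′
  here-there-join x y v (there _ (there _ r)) =
    _ , [ there (x + y) r ] , [ here x y _ ]

  ↝-subcommutative : Subcommutative _↝_
  ↝-subcommutative (here x y v)  (here _ _ _)  = _ , stay , stay
  ↝-subcommutative (here x y v)  (there _ r)   = here-there-join x y v r
  ↝-subcommutative (there _ r)   (here x y v)
    with here-there-join x y v r
  ... | t , p , q = t , q , p
  ↝-subcommutative (there z r)   (there _ r′)
    with ↝-subcommutative r r′
  ... | t , p , q = z ∷ t , there⁼ z p , there⁼ z q

  Interior⇒Reduced : ∀ {u} → Interior u → Reduced u
  Interior⇒Reduced {[]}        _       = _
  Interior⇒Reduced {_ ∷ []}    _       = _
  Interior⇒Reduced {_ ∷ _ ∷ _} (_ , i) = i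

  Reduced⇒IsNormalForm : ∀ {u} → Reduced u → IsNormalForm _↝_ u
  Reduced⇒IsNormalForm (0≢0 , _) (_ , here _ _ _) = 0≢0 refl
  Reduced⇒IsNormalForm red       (_ , there _ r)  =
    Reduced⇒IsNormalForm (Interior⇒Reduced red) (_ , r)

  ∼ₛ-reduced-unique : ∀ {u w} → Reduced u → Reduced w → u ∼ₛ w → u ≡ w
  ∼ₛ-reduced-unique red red′ u∼w =
    conf⇒unf (subcommutative⇒confluent ↝-subcommutative)
      (Reduced⇒IsNormalForm red) (Reduced⇒IsNormalForm red′)
      (EqClosure.map Step⇒↝ u∼w)

  ↝-preserves-null : ∀ {u w} → u ↝ w → null u ≡ null w
  ↝-preserves-null (here _ _ _) = refl
  ↝-preserves-null (there _ _)  = refl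

  ∼ₛ-preserves-null : ∀ {u w} → u ∼ₛ w → null u ≡ null w
  ∼ₛ-preserves-null u∼w =
    EqClosure.gfold isEquivalence null ↝-preserves-null (EqClosure.map Step⇒↝ u∼w)

  SF-nonempty : ∀ P → null (SF P) ≡ false
  SF-nonempty (pcf []      (_ ∷⁺ _)) = refl
  SF-nonempty (pcf (_ ∷ _) _)        = refl

  []≁SF : ∀ P → [] ∼ₛ SF P → ⊥
  []≁SF P []∼SF with trans (∼ₛ-preserves-null []∼SF) (SF-nonempty P)
  ... | ()

proposition4p8 : {c ℓ : Level} (R : CommutativeRing c ℓ) →
    (∀ {x y} → CommutativeRing._≈_ R x y → x ≡ y) →
    let open PCFDefs R in
    (P : PCF) (s : List (CommutativeRing.Carrier R)) →
    Reduced s → s ∼ₛ SF P →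
    Σ[ s⁺ ∈ List⁺ (CommutativeRing.Carrier R) ]
      (toList s⁺ ≡ s ×
       ReducedRCF (SR s⁺) ×
       SR s⁺ ∼ P ×
       ((Q : PCF) → ReducedRCF Q → Q ∼ P → Q ≡ SR s⁺))
proposition4p8 R ≈⇒≡ P []       _   []∼SF = ⊥-elim ([]≁SF P []∼SF)
  where open Contraction R ≈⇒≡
proposition4p8 R ≈⇒≡ P (x ∷ xs) red s∼SF =
  x ∷⁺ xs , refl , (refl , red) , s∼SF , unique
  where
  open Contraction R ≈⇒≡
  open PCFDefs R

  unique : (Q : PCF) → ReducedRCF Q → Q ∼ P → Q ≡ SR (x ∷⁺ xs)
  unique (pcf [] (q ∷⁺ qs)) (refl , redQ) Q∼P
    with ∼ₛ-reduced-unique redQ red (Q∼P ◅◅ EqClosure.symmetric Step s∼SF)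
  ... | refl = refl
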